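{- Let $k\ge 1$ and let $W_{2k+1}$ be the odd wheel, consisting of a circuit $C_{2k+1}$ of length $2k+1$ together with one further vertex adjacent to every vertex of $C_{2k+1}$. Then the antibalanced odd wheel $-W_{2k+1}=(W_{2k+1},E(W_{2k+1}))$ (all edges negative) is $(k+1)$-critical.
   Context: A signed graph $(G,\Sigma)$ is a graph with a set $\Sigma\subseteq E(G)$ of negative edges. A circuit is negative if it has an odd number of edges in $\Sigma$; $(G,\Sigma)$ is balanced if it has no negative circuit. The frustration index $l(G,\Sigma)$ is the minimum size of $E\subseteq E(G)$ with $(G-E,\Sigma-E)$ balanced. For $k\ge1$, $(G,\Sigma)$ is $k$-critical if $l(G,\Sigma)=k$ and $l(G-e,\Sigma-\{e\})<k$ for every edge $e$. -}

module Defs where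

open import Data.Nat using (ℕ; zero; suc; _+_; _<_; _≤_; _%_)
open import Data.Nat.Properties using (_≟_)
open import Data.Fin using (Fin; zero; suc; toℕ; lower₁; splitAt)
open import Data.Fin.Subset using (Subset; _∈_; _∉_; _⊆_; _─_; ⁅_⁆; ∣_∣; ⊤; ∁)
open import Data.Fin.Subset.Properties using (drop-there)
open import Data.Vec using (_∷_; here; there)
open import Data.Vec using (lookup)
open import Data.Product using (_×_; _,_; Σ; ∃; ∃-syntax; proj₁; proj₂)
open import Data.Sum using (_⊎_; inj₁; inj₂; [_,_])
open import Data.Bool using (Bool; true; false)
open import Function.Definitions using (Injective)
open import Relation.Binary.PropositionalEquality using (_≡_)
open import Relation.Nullary using (¬_; yes; no)

-- A (finite multi)graph: vertex set Fin n, a finite pool of edge labels Fin m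
-- with endpoints, and the edge set E(G) ⊆ Fin m of edges actually present.
record Graph : Set where
  field
    n     : ℕ
    m     : ℕ
    ends  : Fin m → Fin n × Fin n
    edges : Subset m
open Graph public

record SignedGraph : Set where
  field
    graph : Graph
    neg   : Subset (m graph)
    neg⊆  : neg ⊆ edges graph
open SignedGraph public

Joins : (G : Graph) → Fin (m G) → Fin (n G) → Fin (n G) → Set
Joins G e x y = ends G e ≡ (x , y) ⊎ ends G e ≡ (y , x)

next : ∀ {l} → Fin (suc l) → Fin (suc l)
next {l} i with l ≟ toℕ i
... | yes _ = zero
... | no ne = suc (lower₁ i ne)

count : ∀ {l} → (Fin l → Bool) → ℕ
count {zero}  p = 0
count {suc l} p with p zero
... | true  = suc (count (λ i → p (suc i)))
... | false = count (λ i → p (suc i))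

─-mono : ∀ {k} (a b x : Subset k) → a ⊆ b → (a ─ x) ⊆ (b ─ x)
─-mono (true ∷ a) (b₀ ∷ b) (false ∷ x) a⊆b here with a⊆b here
... | here = here
─-mono (false ∷ a) b (false ∷ x) a⊆b {zero} ()
─-mono (false ∷ a) b (true ∷ x) a⊆b {zero} ()
─-mono (true ∷ a) b (true ∷ x) a⊆b {zero} ()
─-mono (a₀ ∷ a) (b₀ ∷ b) (x₀ ∷ x) a⊆b (there i∈) =
  there (─-mono a b x (λ j∈ → drop-there (a⊆b (there j∈))) i∈)

_−ₑ_ : (S : SignedGraph) → Subset (m (graph S)) → SignedGraph
S −ₑ X = record
  { graph = record { n = n G ; m = m G ; ends = ends G ; edges = edges G ─ X }
  ; neg   = neg S ─ X
  ; neg⊆  = ─-mono (neg S) (edges G) X (neg⊆ S) }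
  where G = graph S

-- a circuit of length l+1 in G: distinct vertices v₀ … v_l and distinct
-- edges e₀ … e_l of G, e_i joining v_i and v_{i+1 mod (l+1)}
record Circuit (G : Graph) : Set where
  field
    len    : ℕ
    vtx    : Fin (suc len) → Fin (n G)
    edg    : Fin (suc len) → Fin (m G)
    vtx-inj : Injective _≡_ _≡_ vtx
    edg-inj : Injective _≡_ _≡_ edg
    edg∈   : ∀ i → edg i ∈ edges G
    joins  : ∀ i → Joins G (edg i) (vtx i) (vtx (next i))
open Circuit public

NegativeCircuit : (S : SignedGraph) → Circuit (graph S) → Set
NegativeCircuit S C = count (λ i → lookup (neg S) (edg C i)) % 2 ≡ 1

Balanced : SignedGraph → Set
Balanced S = ∀ (C : Circuit (graph S)) → ¬ NegativeCircuit S C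

FrustrationIndex : SignedGraph → ℕ → Set
FrustrationIndex S k =
  (∃[ X ] (X ⊆ edges (graph S) × ∣ X ∣ ≡ k × Balanced (S −ₑ X)))
  × (∀ X → X ⊆ edges (graph S) → Balanced (S −ₑ X) → k ≤ ∣ X ∣)

Critical : ℕ → SignedGraph → Set
Critical k S =
  FrustrationIndex S k
  × (∀ e → e ∈ edges (graph S) → ∃[ j ] (j < k × FrustrationIndex (S −ₑ ⁅ e ⁆) j))

-- the odd wheel W_{2k+1}: vertex 0 is the hub, vertices suc i (i : Fin (2k+1))
-- form the rim circuit; edge labels Fin (N + N), N = 2k+1: the first N are
-- rim edges {suc i , suc (i+1 mod N)}, the last N are spokes {0 , suc i}.
wheelEnds : (N : ℕ) → Fin (suc N + suc N) → Fin (suc (suc N)) × Fin (suc (suc N))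
wheelEnds N e = [ (λ i → suc i , suc (next i)) , (λ i → zero , suc i) ] (splitAt (suc N) e)

oddWheel : ℕ → Graph
oddWheel k = record
  { n = suc (suc (k + k)) ; m = suc (k + k) + suc (k + k)
  ; ends = wheelEnds (k + k) ; edges = ⊤ }

antibalanced : Graph → SignedGraph
antibalanced G = record { graph = G ; neg = edges G ; neg⊆ = λ x → x }

-- Deleting the edges whose ends get equal colours under a 2-colouring leaves a bipartite,
-- hence balanced, all-negative graph.  Colouring the rim of W_{2k+1} alternately from some
-- vertex and the hub like the odd rim vertices makes exactly one rim edge and k spokes
-- monochromatic, so l(-W_{2k+1}) ≤ k+1; rotating the starting vertex puts any given edge
-- into such a set, so deleting that edge leaves frustration index ≤ k.  Conversely the
-- 2k+1 triangles hub–i–(i+1) are negative, so a balancing set meets each of them; a spoke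
-- lies in two triangles and a rim edge in one, so r + 2s ≥ 2k+1 for a balancing set with
-- r rim edges and s spokes, forcing r + s ≥ k+1 (and ≥ k once one edge is already gone).

module Submission where

open import Defs
open import Data.Bool using (Bool; true; false)
open import Data.Fin using (Fin; zero; suc; toℕ; inject₁; fromℕ; _↑ˡ_; _↑ʳ_; splitAt)
open import Data.Fin.Properties as Fin using (toℕ-injective; toℕ<n; toℕ-fromℕ; toℕ-inject₁; toℕ-lower₁; splitAt-↑ˡ; splitAt-↑ʳ; splitAt⁻¹-↑ˡ; splitAt⁻¹-↑ʳ; ↑ʳ-injective)
open import Data.Fin.Subset using (Subset; _∈_; _∉_; _─_; _-_; _∪_; ⁅_⁆; ⊤; ∣_∣)
open import Data.Fin.Subset.Properties using (_∈?_; ∈⊤; ⊆⊤; x∈p∧x∉q⇒x∈p─q; p─q⊆p; x∈p∪q⁺; ∣p∣≤∣x∷p∣; ∣⁅x⁆∣≡1; x∈p⇒∣p-x∣<∣p∣)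
open import Data.Nat using (ℕ; zero; suc; _+_; _*_; _∸_; _≤_; _<_; _%_; z≤n; s≤s; parity)
open import Data.Nat.DivMod using (m*n%n≡0)
open import Data.Nat.Properties
open import Data.Parity.Base using (Parity; 0ℙ; 1ℙ; _⁻¹)
open import Data.Parity.Properties using (+-homo-+; p+p≡0ℙ; p≢p⁻¹; suc-homo-⁻¹) renaming (_≟_ to _≟ℙ_)
open import Data.Product using (_×_; _,_; proj₁; proj₂; ∃-syntax)
open import Data.Sum as Sum using (_⊎_; inj₁; inj₂)
open import Data.Vec using (_∷_; []; lookup; tabulate; here; there)
open import Data.Vec.Functional using (init)
open import Data.Vec.Properties using ([]=⇒lookup; lookup⇒[]=; lookup∘tabulate)
open import Function using (_∘_; id)
open import Function.Definitions using (Injective)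
open import Relation.Binary.PropositionalEquality
open import Relation.Nullary using (¬_; yes; no; does; contradiction)
open import Relation.Nullary.Decidable using (dec-true; dec-false)
open import Algebra.Properties.CommutativeMonoid.Sum +-0-commutativeMonoid
  using (sum; sum-syntax; sum-cong-≗; sum-init-last; sum-replicate-zero; ∑-distrib-+)

indicator : Bool → ℕ
indicator true  = 1
indicator false = 0

∑-one : ∀ n → ∑[ i < n ] 1 ≡ n
∑-one zero    = refl
∑-one (suc n) = cong suc (∑-one n)

∑-mono-≤ : ∀ {n} {f g : Fin n → ℕ} → (∀ i → f i ≤ g i) → sum f ≤ sum g
∑-mono-≤ {zero}  f≤g = z≤n
∑-mono-≤ {suc n} f≤g = +-mono-≤ (f≤g zero) (∑-mono-≤ (f≤g ∘ suc))

∑-split : ∀ m {n} (f : Fin (m + n) → ℕ) → sum f ≡ ∑[ i < m ] f (i ↑ˡ n) + ∑[ i < n ] f (m ↑ʳ i)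
∑-split zero    f = refl
∑-split (suc m) f = trans (cong (f zero +_) (∑-split m (f ∘ suc))) (sym (+-assoc (f zero) _ _))

∣p∣≡∑indicator : ∀ {n} (p : Subset n) → ∣ p ∣ ≡ ∑[ i < n ] indicator (lookup p i)
∣p∣≡∑indicator []          = refl
∣p∣≡∑indicator (true  ∷ p) = cong suc (∣p∣≡∑indicator p)
∣p∣≡∑indicator (false ∷ p) = ∣p∣≡∑indicator p

x∈p─q⇒x∉q : ∀ {n} {x : Fin n} (p q : Subset n) → x ∈ p ─ q → x ∉ q
x∈p─q⇒x∉q (true  ∷ p) (false ∷ q) here       ()
x∈p─q⇒x∉q (_     ∷ p) (_     ∷ q) (there x∈) (there x∈q) = x∈p─q⇒x∉q p q x∈ x∈q

x∉p─q⇒x∉p⊎x∈q : ∀ {n} {x : Fin n} {p q : Subset n} → x ∉ p ─ q → x ∉ p ⊎ x ∈ q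
x∉p─q⇒x∉p⊎x∈q {x = x} {q = q} x∉p─q with x ∈? q
... | yes x∈q = inj₂ x∈q
... | no  x∉q = inj₁ λ x∈p → x∉p─q (x∈p∧x∉q⇒x∈p─q x∈p x∉q)

x∉⊤─q⇒x∈q : ∀ {n} {x : Fin n} {q : Subset n} → x ∉ ⊤ ─ q → x ∈ q
x∉⊤─q⇒x∈q = Sum.[ contradiction ∈⊤ , id ] ∘ x∉p─q⇒x∉p⊎x∈q

x∈p─r─[q─r]⇒x∉q : ∀ {n} {x : Fin n} (p q r : Subset n) → x ∈ (p ─ r) ─ (q ─ r) → x ∉ q
x∈p─r─[q─r]⇒x∉q p q r x∈ x∈q with x∉p─q⇒x∉p⊎x∈q (x∈p─q⇒x∉q _ (q ─ r) x∈)
... | inj₁ x∉q = x∉q x∈q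
... | inj₂ x∈r = x∈p─q⇒x∉q p r (p─q⊆p _ _ x∈) x∈r

∣p∪q∣≤∣p∣+∣q∣ : ∀ {n} (p q : Subset n) → ∣ p ∪ q ∣ ≤ ∣ p ∣ + ∣ q ∣
∣p∪q∣≤∣p∣+∣q∣ []          []          = z≤n
∣p∪q∣≤∣p∣+∣q∣ (true  ∷ p) (y     ∷ q) = s≤s (≤-trans (∣p∪q∣≤∣p∣+∣q∣ p q) (+-monoʳ-≤ ∣ p ∣ (∣p∣≤∣x∷p∣ y q)))
∣p∪q∣≤∣p∣+∣q∣ (false ∷ p) (true  ∷ q) = ≤-trans (s≤s (∣p∪q∣≤∣p∣+∣q∣ p q)) (≤-reflexive (sym (+-suc ∣ p ∣ ∣ q ∣)))
∣p∪q∣≤∣p∣+∣q∣ (false ∷ p) (false ∷ q) = ∣p∪q∣≤∣p∣+∣q∣ p q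

toℕ-next : ∀ {l} (i : Fin (suc l)) → toℕ i < l → toℕ (next i) ≡ suc (toℕ i)
toℕ-next {l} i i<l with l ≟ toℕ i
... | yes l≡i = contradiction (sym l≡i) (<⇒≢ i<l)
... | no  l≢i = cong suc (toℕ-lower₁ i l≢i)

next-inject₁ : ∀ {l} (i : Fin l) → next (inject₁ i) ≡ suc i
next-inject₁ i = toℕ-injective (trans (toℕ-next (inject₁ i) (subst (_< _) (sym (toℕ-inject₁ i)) (toℕ<n i)))
                                      (cong suc (toℕ-inject₁ i)))

next-fromℕ : ∀ l → next (fromℕ l) ≡ zero
next-fromℕ l with l ≟ toℕ (fromℕ l)
... | yes _   = refl
... | no  l≢l = contradiction (sym (toℕ-fromℕ l)) l≢l

next-≢ : ∀ {l} (i : Fin (suc (suc l))) → next i ≢ i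
next-≢ {l} i next-i≡i with suc l ≟ toℕ i
... | yes l≡i = 0≢1+n (trans (cong toℕ next-i≡i) (sym l≡i))
... | no  l≢i = 1+n≢n (trans (cong suc (sym (toℕ-lower₁ i l≢i))) (cong toℕ next-i≡i))

∑-next : ∀ {l} (f : Fin (suc l) → ℕ) → sum (f ∘ next) ≡ sum f
∑-next {l} f = begin
  sum (f ∘ next)                             ≡⟨ sum-init-last (f ∘ next) ⟩
  sum (init (f ∘ next)) + f (next (fromℕ l)) ≡⟨ cong₂ _+_ (sum-cong-≗ (cong f ∘ next-inject₁)) (cong f (next-fromℕ l)) ⟩
  sum (f ∘ suc) + f zero                     ≡⟨ +-comm _ (f zero) ⟩
  sum f                                      ∎
  where open ≡-Reasoning

rotate : ∀ {l} → ℕ → Fin (suc l) → Fin (suc l)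
rotate zero    i = i
rotate (suc c) i = rotate c (next i)

rotate-next : ∀ {l} c (i : Fin (suc l)) → rotate c (next i) ≡ next (rotate c i)
rotate-next zero    i = refl
rotate-next (suc c) i = rotate-next c (next i)

rotate-+ : ∀ {l} a b (i : Fin (suc l)) → rotate (a + b) i ≡ rotate b (rotate a i)
rotate-+ zero    b i = refl
rotate-+ (suc a) b i = rotate-+ a b (next i)

∑-rotate : ∀ {l} c (f : Fin (suc l) → ℕ) → sum (f ∘ rotate c) ≡ sum f
∑-rotate zero    f = refl
∑-rotate (suc c) f = trans (∑-next (f ∘ rotate c)) (∑-rotate c f)

toℕ-rotate : ∀ {l} c (i : Fin (suc l)) → toℕ i + c ≤ l → toℕ (rotate c i) ≡ toℕ i + c
toℕ-rotate zero    i _ = sym (+-identityʳ (toℕ i))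
toℕ-rotate {l} (suc c) i i+c≤l = begin
  toℕ (rotate c (next i)) ≡⟨ toℕ-rotate c (next i) (subst (_≤ l) (sym next-i+c) i+c≤l) ⟩
  toℕ (next i) + c        ≡⟨ next-i+c ⟩
  toℕ i + suc c           ∎
  where
  open ≡-Reasoning
  next-i+c : toℕ (next i) + c ≡ toℕ i + suc c
  next-i+c = trans (cong (_+ c) (toℕ-next i (<-≤-trans (m<m+n (toℕ i) (s≤s z≤n)) i+c≤l)))
                   (sym (+-suc (toℕ i) c))

rotate-surjective : ∀ {l} (i j : Fin (suc l)) → ∃[ c ] rotate c i ≡ j
rotate-surjective {l} i j = l ∸ toℕ i + suc (toℕ j) , (begin
  rotate (l ∸ toℕ i + suc (toℕ j)) i           ≡⟨ rotate-+ (l ∸ toℕ i) (suc (toℕ j)) i ⟩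
  rotate (toℕ j) (next (rotate (l ∸ toℕ i) i)) ≡⟨ cong (rotate (toℕ j) ∘ next) to-last ⟩
  rotate (toℕ j) (next (fromℕ l))              ≡⟨ cong (rotate (toℕ j)) (next-fromℕ l) ⟩
  rotate (toℕ j) zero                          ≡⟨ toℕ-injective (toℕ-rotate (toℕ j) zero (≤-pred (toℕ<n j))) ⟩
  j                                            ∎)
  where
  open ≡-Reasoning
  i≤l : toℕ i ≤ l
  i≤l = ≤-pred (toℕ<n i)
  to-last : rotate (l ∸ toℕ i) i ≡ fromℕ l
  to-last = toℕ-injective (trans (toℕ-rotate (l ∸ toℕ i) i (≤-reflexive (m+[n∸m]≡n i≤l)))
                                 (trans (m+[n∸m]≡n i≤l) (sym (toℕ-fromℕ l))))

≢⇒≡⁻¹ : ∀ {p q : Parity} → p ≢ q → q ≡ p ⁻¹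
≢⇒≡⁻¹ {0ℙ} {0ℙ} p≢q = contradiction refl p≢q
≢⇒≡⁻¹ {0ℙ} {1ℙ} _   = refl
≢⇒≡⁻¹ {1ℙ} {0ℙ} _   = refl
≢⇒≡⁻¹ {1ℙ} {1ℙ} p≢q = contradiction refl p≢q

parity[k+k]≡0ℙ : ∀ k → parity (k + k) ≡ 0ℙ
parity[k+k]≡0ℙ k = trans (+-homo-+ k k) (p+p≡0ℙ (parity k))

parity≢parity-suc : ∀ n → parity n ≢ parity (suc n)
parity≢parity-suc n eq = p≢p⁻¹ (parity (suc n)) (trans (sym eq) (sym (suc-homo-⁻¹ n)))

alternating⇒even : ∀ {l} (f : Fin (suc l) → Parity) → (∀ i → f (next i) ≡ f i ⁻¹) → suc l % 2 ≡ 0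
alternating⇒even {l} f alternates = begin
  suc l % 2                            ≡⟨ cong (_% 2) (∑-one (suc l)) ⟨
  ∑[ i < suc l ] 1 % 2                 ≡⟨ cong (_% 2) (sum-cong-≗ one-of-two) ⟨
  sum (λ i → odd i + odd (next i)) % 2 ≡⟨ cong (_% 2) (∑-distrib-+ odd (odd ∘ next)) ⟩
  (sum odd + sum (odd ∘ next)) % 2     ≡⟨ cong (λ s → (sum odd + s) % 2) (∑-next odd) ⟩
  (sum odd + sum odd) % 2              ≡⟨ cong (_% 2) (trans (cong (sum odd +_) (sym (+-identityʳ _))) (*-comm 2 (sum odd))) ⟩
  sum odd * 2 % 2                      ≡⟨ m*n%n≡0 (sum odd) 2 ⟩
  0                                    ∎
  where
  open ≡-Reasoning
  odd : Fin (suc l) → ℕ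
  odd i = indicator (does (1ℙ ≟ℙ f i))
  one-of-two : ∀ i → odd i + odd (next i) ≡ 1
  one-of-two i rewrite alternates i with f i
  ... | 0ℙ = refl
  ... | 1ℙ = refl

count-true : ∀ {l} (p : Fin l → Bool) → (∀ i → p i ≡ true) → count p ≡ l
count-true {zero}  p _   = refl
count-true {suc l} p all with p zero | all zero
... | .true | refl = cong suc (count-true (p ∘ suc) (all ∘ suc))

count-all-negative : (S : SignedGraph) (C : Circuit (graph S)) → (∀ i → edg C i ∈ neg S) →
                     count (λ i → lookup (neg S) (edg C i)) ≡ suc (len C)
count-all-negative S C negative = count-true _ ([]=⇒lookup ∘ negative)

properly-coloured⇒balanced : (G : Graph) (col : Fin (n G) → Parity) →
  (∀ {e} → e ∈ edges G → col (proj₁ (ends G e)) ≢ col (proj₂ (ends G e))) →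
  Balanced (antibalanced G)
properly-coloured⇒balanced G col proper C negative =
  0≢1+n (trans (sym (alternating⇒even (col ∘ vtx C) alternates))
               (trans (cong (_% 2) (sym (count-all-negative (antibalanced G) C (edg∈ C)))) negative))
  where
  alternates : ∀ i → col (vtx C (next i)) ≡ col (vtx C i) ⁻¹
  alternates i with ends G (edg C i) | joins C i | proper (edg∈ C i)
  ... | _ | inj₁ refl | differ = ≢⇒≡⁻¹ differ
  ... | _ | inj₂ refl | differ = ≢⇒≡⁻¹ (differ ∘ sym)

monochromatic : (G : Graph) → (Fin (n G) → Parity) → Subset (m G)
monochromatic G col = tabulate λ e → does (col (proj₁ (ends G e)) ≟ℙ col (proj₂ (ends G e)))

lookup-monochromatic : ∀ G col e →
  lookup (monochromatic G col) e ≡ does (col (proj₁ (ends G e)) ≟ℙ col (proj₂ (ends G e)))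
lookup-monochromatic G col e = lookup∘tabulate _ e

monochromatic⁺ : ∀ G col {e} → col (proj₁ (ends G e)) ≡ col (proj₂ (ends G e)) → e ∈ monochromatic G col
monochromatic⁺ G col {e} same = lookup⇒[]= e _ (trans (lookup-monochromatic G col e) (dec-true (_ ≟ℙ _) same))

∉monochromatic⇒≢ : ∀ G col {e} → e ∉ monochromatic G col → col (proj₁ (ends G e)) ≢ col (proj₂ (ends G e))
∉monochromatic⇒≢ G col e∉ = e∉ ∘ monochromatic⁺ G col

avoids-monochromatic⇒balanced : (G : Graph) (col : Fin (n G) → Parity) →
  (∀ {e} → e ∈ edges G → e ∉ monochromatic G col) → Balanced (antibalanced G)
avoids-monochromatic⇒balanced G col avoids =
  properly-coloured⇒balanced G col (∉monochromatic⇒≢ G col ∘ avoids)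

Distinct₃ : {A : Set} → A → A → A → Set
Distinct₃ x y z = x ≢ y × y ≢ z × z ≢ x

lookup-injective₃ : ∀ {A : Set} {x y z : A} → Distinct₃ x y z → Injective _≡_ _≡_ (lookup (x ∷ y ∷ z ∷ []))
lookup-injective₃ _             {zero}           {zero}           _  = refl
lookup-injective₃ _             {suc zero}       {suc zero}       _  = refl
lookup-injective₃ _             {suc (suc zero)} {suc (suc zero)} _  = refl
lookup-injective₃ (x≢y , _ , _) {zero}           {suc zero}       eq = contradiction eq x≢y
lookup-injective₃ (x≢y , _ , _) {suc zero}       {zero}           eq = contradiction (sym eq) x≢y
lookup-injective₃ (_ , y≢z , _) {suc zero}       {suc (suc zero)} eq = contradiction eq y≢z
lookup-injective₃ (_ , y≢z , _) {suc (suc zero)} {suc zero}       eq = contradiction (sym eq) y≢z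
lookup-injective₃ (_ , _ , z≢x) {suc (suc zero)} {zero}           eq = contradiction eq z≢x
lookup-injective₃ (_ , _ , z≢x) {zero}           {suc (suc zero)} eq = contradiction (sym eq) z≢x

triangle : (G : Graph) {x y z : Fin (n G)} {a b c : Fin (m G)} →
  Distinct₃ x y z → Distinct₃ a b c → Joins G a x y → Joins G b y z → Joins G c z x →
  a ∈ edges G → b ∈ edges G → c ∈ edges G → Circuit G
triangle G {x} {y} {z} {a} {b} {c} xyz abc a-xy b-yz c-zx a∈ b∈ c∈ = record
  { len = 2 ; vtx = lookup (x ∷ y ∷ z ∷ []) ; edg = lookup (a ∷ b ∷ c ∷ [])
  ; vtx-inj = lookup-injective₃ xyz ; edg-inj = lookup-injective₃ abc
  ; edg∈ = λ { zero → a∈ ; (suc zero) → b∈ ; (suc (suc zero)) → c∈ }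
  ; joins = λ { zero → a-xy ; (suc zero) → b-yz ; (suc (suc zero)) → c-zx } }

wheel : (l : ℕ) → Subset (suc l + suc l) → Graph
wheel l E = record { n = suc (suc l) ; m = suc l + suc l ; ends = wheelEnds l ; edges = E }

rim : ∀ {l} → Fin (suc l) → Fin (suc l + suc l)
rim {l} i = i ↑ˡ suc l

spoke : ∀ {l} → Fin (suc l) → Fin (suc l + suc l)
spoke {l} i = suc l ↑ʳ i

wheelEnds-rim : ∀ {l} (i : Fin (suc l)) → wheelEnds l (rim i) ≡ (suc i , suc (next i))
wheelEnds-rim {l} i rewrite splitAt-↑ˡ (suc l) i (suc l) = refl

wheelEnds-spoke : ∀ {l} (i : Fin (suc l)) → wheelEnds l (spoke i) ≡ (zero , suc i)
wheelEnds-spoke {l} i rewrite splitAt-↑ʳ (suc l) (suc l) i = refl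

rim≢spoke : ∀ {l} (i j : Fin (suc l)) → rim i ≢ spoke j
rim≢spoke {l} i j rim≡spoke
  with () ← trans (sym (splitAt-↑ˡ (suc l) i (suc l)))
                  (trans (cong (splitAt (suc l)) rim≡spoke) (splitAt-↑ʳ (suc l) (suc l) j))

rim-or-spoke : ∀ {l} (e : Fin (suc l + suc l)) → (∃[ i ] rim i ≡ e) ⊎ (∃[ i ] spoke i ≡ e)
rim-or-spoke {l} e with splitAt (suc l) e in split
... | inj₁ i = inj₁ (i , splitAt⁻¹-↑ˡ split)
... | inj₂ i = inj₂ (i , splitAt⁻¹-↑ʳ split)

wheel-triangle-unbalanced : ∀ {l} (E : Subset (suc (suc l) + suc (suc l))) i →
  rim i ∈ E → spoke i ∈ E → spoke (next i) ∈ E → ¬ Balanced (antibalanced (wheel (suc l) E))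
wheel-triangle-unbalanced {l} E i rim∈ spoke∈ spoke-next∈ balanced =
  balanced C (cong (_% 2) (count-all-negative (antibalanced (wheel (suc l) E)) C (edg∈ C)))
  where
  C : Circuit (wheel (suc l) E)
  C = triangle (wheel (suc l) E)
        (next-≢ i ∘ sym ∘ Fin.suc-injective , (λ ()) , (λ ()))
        (rim≢spoke i (next i) , next-≢ i ∘ ↑ʳ-injective (suc (suc l)) (next i) i , rim≢spoke i i ∘ sym)
        (inj₁ (wheelEnds-rim i)) (inj₂ (wheelEnds-spoke (next i))) (inj₁ (wheelEnds-spoke i))
        rim∈ spoke-next∈ spoke∈

balanced-wheel-misses-triangle : ∀ {l} (E : Subset (suc (suc l) + suc (suc l))) →
  Balanced (antibalanced (wheel (suc l) E)) →
  ∀ i → rim i ∉ E ⊎ spoke i ∉ E ⊎ spoke (next i) ∉ E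
balanced-wheel-misses-triangle E balanced i with rim i ∈? E | spoke i ∈? E | spoke (next i) ∈? E
... | no rim∉      | _             | _                  = inj₁ rim∉
... | yes _        | no spoke∉     | _                  = inj₂ (inj₁ spoke∉)
... | yes _        | yes _         | no spoke-next∉     = inj₂ (inj₂ spoke-next∉)
... | yes rim∈     | yes spoke∈    | yes spoke-next∈    =
  contradiction balanced (wheel-triangle-unbalanced E i rim∈ spoke∈ spoke-next∈)

∣∣-rim-spoke : ∀ {l} (Z : Subset (suc l + suc l)) →
  ∣ Z ∣ ≡ ∑[ i < suc l ] indicator (lookup Z (rim i)) + ∑[ i < suc l ] indicator (lookup Z (spoke i))
∣∣-rim-spoke {l} Z = trans (∣p∣≡∑indicator Z) (∑-split (suc l) (indicator ∘ lookup Z))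

half-bound : ∀ k a b → suc (k + k) ≤ a + b + b → suc k ≤ a + b
half-bound k a b 2k<a+2b = ≮⇒≥ λ a+b<1+k →
  let a+b≤k = ≤-pred a+b<1+k
  in <-irrefl refl (≤-trans 2k<a+2b (+-mono-≤ a+b≤k (≤-trans (m≤n+m b a) a+b≤k)))

triangle-cover-bound : ∀ k (Z : Subset (suc (k + k) + suc (k + k))) →
  (∀ i → rim i ∈ Z ⊎ spoke i ∈ Z ⊎ spoke (next i) ∈ Z) → suc k ≤ ∣ Z ∣
triangle-cover-bound k Z covers = subst (suc k ≤_) (sym (∣∣-rim-spoke Z)) (half-bound k r s (begin
  suc (k + k)                                      ≡⟨ ∑-one (suc (k + k)) ⟨
  ∑[ i < suc (k + k) ] 1                           ≤⟨ ∑-mono-≤ hit ⟩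
  ∑[ i < suc (k + k) ] (rᵢ i + sᵢ i + sᵢ (next i)) ≡⟨ ∑-distrib-+ (λ i → rᵢ i + sᵢ i) (sᵢ ∘ next) ⟩
  sum (λ i → rᵢ i + sᵢ i) + sum (sᵢ ∘ next)        ≡⟨ cong₂ _+_ (∑-distrib-+ rᵢ sᵢ) (∑-next sᵢ) ⟩
  r + s + s                                        ∎))
  where
  open ≤-Reasoning
  rᵢ sᵢ : Fin (suc (k + k)) → ℕ
  rᵢ i = indicator (lookup Z (rim i))
  sᵢ i = indicator (lookup Z (spoke i))
  r s : ℕ
  r = sum rᵢ
  s = sum sᵢ
  ∈⇒1≤indicator : ∀ {e} → e ∈ Z → 1 ≤ indicator (lookup Z e)
  ∈⇒1≤indicator e∈Z rewrite []=⇒lookup e∈Z = ≤-refl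
  hit : ∀ i → 1 ≤ rᵢ i + sᵢ i + sᵢ (next i)
  hit i with covers i
  ... | inj₁ rim∈          = ≤-trans (∈⇒1≤indicator rim∈) (≤-trans (m≤m+n _ _) (m≤m+n _ _))
  ... | inj₂ (inj₁ spoke∈) = ≤-trans (∈⇒1≤indicator spoke∈) (≤-trans (m≤n+m _ (rᵢ i)) (m≤m+n _ _))
  ... | inj₂ (inj₂ spoke∈) = ≤-trans (∈⇒1≤indicator spoke∈) (m≤n+m _ _)

balancing-set-bound : ∀ k → 1 ≤ k → (E Z : Subset (suc (k + k) + suc (k + k))) →
  (∀ {e} → e ∉ E → e ∈ Z) → Balanced (antibalanced (wheel (k + k) E)) → suc k ≤ ∣ Z ∣
balancing-set-bound (suc k) _ E Z ∁E⊆Z balanced = triangle-cover-bound (suc k) Z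
  (Sum.map ∁E⊆Z (Sum.map ∁E⊆Z ∁E⊆Z) ∘ balanced-wheel-misses-triangle E balanced)

rotationColouring : ∀ {l} → ℕ → Fin (suc (suc l)) → Parity
rotationColouring c zero    = 1ℙ
rotationColouring c (suc i) = parity (toℕ (rotate c i))

∑-odd : ∀ k → ∑[ j < suc (k + k) ] indicator (does (1ℙ ≟ℙ parity (toℕ j))) ≡ k
∑-odd zero                      = refl
∑-odd (suc k) rewrite +-suc k k = cong suc (∑-odd k)

∑-same-parity-as-next : ∀ l → parity l ≡ 0ℙ →
  ∑[ j < suc l ] indicator (does (parity (toℕ j) ≟ℙ parity (toℕ (next j)))) ≡ 1
∑-same-parity-as-next l parity[l]≡0ℙ = begin
  sum same                              ≡⟨ sum-init-last same ⟩
  sum (same ∘ inject₁) + same (fromℕ l) ≡⟨ cong₂ _+_ (sum-cong-≗ differs) last-same ⟩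
  sum {l} (λ _ → 0) + 1                 ≡⟨ cong (_+ 1) (sum-replicate-zero l) ⟩
  1                                     ∎
  where
  open ≡-Reasoning
  same : Fin (suc l) → ℕ
  same j = indicator (does (parity (toℕ j) ≟ℙ parity (toℕ (next j))))
  differs : ∀ j → same (inject₁ j) ≡ 0
  differs j rewrite next-inject₁ j | toℕ-inject₁ j =
    cong indicator (dec-false (_ ≟ℙ _) (parity≢parity-suc (toℕ j)))
  last-same : same (fromℕ l) ≡ 1
  last-same rewrite next-fromℕ l | toℕ-fromℕ l = cong indicator (dec-true (_ ≟ℙ _) parity[l]≡0ℙ)

module _ (k : ℕ) where

  rotationMonochromatic : ℕ → Subset (m (oddWheel k))
  rotationMonochromatic c = monochromatic (oddWheel k) (rotationColouring c)

  ∣rotationMonochromatic∣≡1+k : ∀ c → ∣ rotationMonochromatic c ∣ ≡ suc k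
  ∣rotationMonochromatic∣≡1+k c = begin
    ∣ rotationMonochromatic c ∣                     ≡⟨ ∣∣-rim-spoke (rotationMonochromatic c) ⟩
    sum rimᵢ + sum spokeᵢ                           ≡⟨ cong₂ _+_ (sum-cong-≗ rim-rotated) (sum-cong-≗ spoke-rotated) ⟩
    sum (same ∘ rotate c) + sum (odd ∘ rotate c)    ≡⟨ cong₂ _+_ (∑-rotate c same) (∑-rotate c odd) ⟩
    sum same + sum odd                              ≡⟨ cong₂ _+_ (∑-same-parity-as-next (k + k) (parity[k+k]≡0ℙ k)) (∑-odd k) ⟩
    suc k                                           ∎
    where
    open ≡-Reasoning
    Y : Subset (m (oddWheel k))
    Y = rotationMonochromatic c
    rimᵢ spokeᵢ same odd : Fin (suc (k + k)) → ℕ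
    rimᵢ i   = indicator (lookup Y (rim i))
    spokeᵢ i = indicator (lookup Y (spoke i))
    same j = indicator (does (parity (toℕ j) ≟ℙ parity (toℕ (next j))))
    odd j  = indicator (does (1ℙ ≟ℙ parity (toℕ j)))
    rim-rotated : ∀ i → rimᵢ i ≡ same (rotate c i)
    rim-rotated i rewrite lookup-monochromatic (oddWheel k) (rotationColouring c) (rim i)
                        | wheelEnds-rim i | rotate-next c i = refl
    spoke-rotated : ∀ i → spokeᵢ i ≡ odd (rotate c i)
    spoke-rotated i rewrite lookup-monochromatic (oddWheel k) (rotationColouring c) (spoke i)
                          | wheelEnds-spoke i = refl

∈rotationMonochromatic : ∀ k → 1 ≤ k → ∀ e → ∃[ c ] e ∈ rotationMonochromatic k c
∈rotationMonochromatic k@(suc _) _ e with rim-or-spoke {k + k} e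
... | inj₁ (i , refl) = let c , i↦last = rotate-surjective i (fromℕ (k + k)) in
  c , monochromatic⁺ (oddWheel k) (rotationColouring c) (rim-same c i i↦last)
  where
  rim-same : ∀ c i → rotate c i ≡ fromℕ (k + k) →
    rotationColouring c (proj₁ (wheelEnds (k + k) (rim i))) ≡ rotationColouring c (proj₂ (wheelEnds (k + k) (rim i)))
  rim-same c i i↦last rewrite wheelEnds-rim i | rotate-next c i | i↦last | next-fromℕ (k + k) | toℕ-fromℕ (k + k) =
    parity[k+k]≡0ℙ k
... | inj₂ (i , refl) = let c , i↦1 = rotate-surjective i (suc zero) in
  c , monochromatic⁺ (oddWheel k) (rotationColouring c) (spoke-same c i i↦1)
  where
  spoke-same : ∀ c i → rotate c i ≡ suc zero →
    rotationColouring c (proj₁ (wheelEnds (k + k) (spoke i))) ≡ rotationColouring c (proj₂ (wheelEnds (k + k) (spoke i)))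
  spoke-same c i i↦1 rewrite wheelEnds-spoke i | i↦1 = refl

oddWheel-balancing-bound : ∀ k → 1 ≤ k → ∀ X → Balanced (antibalanced (oddWheel k) −ₑ X) → suc k ≤ ∣ X ∣
-- antibalanced (oddWheel k) −ₑ X is antibalanced (wheel (k + k) (⊤ ─ X)) except for the
-- proof neg⊆, which Balanced never inspects, so the two are accepted interchangeably.
oddWheel-balancing-bound k 1≤k X = balancing-set-bound k 1≤k (⊤ ─ X) X x∉⊤─q⇒x∈q

oddWheel-minus-edge-balancing-bound : ∀ k → 1 ≤ k → ∀ e X →
  Balanced ((antibalanced (oddWheel k) −ₑ ⁅ e ⁆) −ₑ X) → k ≤ ∣ X ∣
oddWheel-minus-edge-balancing-bound k 1≤k e X balanced = ≤-pred (begin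
  suc k             ≤⟨ balancing-set-bound k 1≤k ((⊤ ─ ⁅ e ⁆) ─ X) (X ∪ ⁅ e ⁆) hits balanced ⟩
  ∣ X ∪ ⁅ e ⁆ ∣      ≤⟨ ∣p∪q∣≤∣p∣+∣q∣ X ⁅ e ⁆ ⟩
  ∣ X ∣ + ∣ ⁅ e ⁆ ∣  ≡⟨ trans (cong (∣ X ∣ +_) (∣⁅x⁆∣≡1 e)) (+-comm ∣ X ∣ 1) ⟩
  suc ∣ X ∣          ∎)
  where
  open ≤-Reasoning
  hits : ∀ {d} → d ∉ (⊤ ─ ⁅ e ⁆) ─ X → d ∈ X ∪ ⁅ e ⁆
  hits = x∈p∪q⁺ ∘ Sum.[ inj₂ ∘ x∉⊤─q⇒x∈q , inj₁ ] ∘ x∉p─q⇒x∉p⊎x∈q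

frustrationIndex-oddWheel : ∀ k → 1 ≤ k → FrustrationIndex (antibalanced (oddWheel k)) (suc k)
frustrationIndex-oddWheel k 1≤k =
  ( rotationMonochromatic k 0 , ⊆⊤ , ∣rotationMonochromatic∣≡1+k k 0
  , avoids-monochromatic⇒balanced _ (rotationColouring 0) (x∈p─q⇒x∉q ⊤ _) )
  , λ X _ → oddWheel-balancing-bound k 1≤k X

frustrationIndex-oddWheel-minus-edge : ∀ k → 1 ≤ k → ∀ e →
  FrustrationIndex (antibalanced (oddWheel k) −ₑ ⁅ e ⁆) k
frustrationIndex-oddWheel-minus-edge k 1≤k e =
  (Y - e , ─-mono Y ⊤ ⁅ e ⁆ ⊆⊤ , ∣Y-e∣ , balanced) , λ X _ → oddWheel-minus-edge-balancing-bound k 1≤k e X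
  where
  c : ℕ
  c = proj₁ (∈rotationMonochromatic k 1≤k e)
  Y : Subset (m (oddWheel k))
  Y = rotationMonochromatic k c
  e∈Y : e ∈ Y
  e∈Y = proj₂ (∈rotationMonochromatic k 1≤k e)
  balanced : Balanced ((antibalanced (oddWheel k) −ₑ ⁅ e ⁆) −ₑ (Y - e))
  balanced = avoids-monochromatic⇒balanced _ (rotationColouring c) (x∈p─r─[q─r]⇒x∉q ⊤ Y ⁅ e ⁆)
  ∣Y-e∣ : ∣ Y - e ∣ ≡ k
  ∣Y-e∣ = ≤-antisym (≤-pred (subst (∣ Y - e ∣ <_) (∣rotationMonochromatic∣≡1+k k c) (x∈p⇒∣p-x∣<∣p∣ e∈Y)))
                    (oddWheel-minus-edge-balancing-bound k 1≤k e (Y - e) balanced)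

proposition2p5 : (k : ℕ) → 1 ≤ k → Critical (suc k) (antibalanced (oddWheel k))
proposition2p5 k 1≤k =
  frustrationIndex-oddWheel k 1≤k , λ e _ → k , ≤-refl , frustrationIndex-oddWheel-minus-edge k 1≤k e
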